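{- (i) For every non-negative integer $m$, \[ {}_{H}w_{m+1}(x)=w_{m+1}(x)+m\,x\,w_{m}(x)+(1+x)\sum_{k=0}^{m-2}\binom{m}{k}w_{m-k-1}(x)\,w_{k+1}(x). \] (ii) For every integer $n\geq 2$, \[ \frac{x}{1+x}\sum_{k=0}^{n}\binom{n}{k}{}_{H}w_{k+1}(x)={}_{H}w_{n+1}(x)-{}_{H}w_{n}(x)-w_{n}(x)+w_{n-1}(x). \]
   Context: $\left\{ {n \atop k}\right\}$ denotes the Stirling number of the second kind. $H_k=\sum_{i=1}^k 1/i$ is the $k$-th harmonic number. The geometric polynomials are $w_m(x)=\sum_{k=0}^{m}\left\{ {m \atop k}\right\} k!\,x^k$, and the harmonic geometric polynomials are ${}_{H}w_m(x)=\sum_{k=1}^{m}\left\{ {m \atop k}\right\} k!\,H_k\,x^k$. Empty sums are zero. -}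

module Defs where

open import Data.Nat as ℕ using (ℕ; zero; suc; _!)
open import Data.Integer using (+_)
open import Data.Rational using (ℚ; 0ℚ; 1ℚ; _+_; _*_; _/_)

infixr 8 _^_
_^_ : ℚ → ℕ → ℚ
x ^ zero  = 1ℚ
x ^ suc n = x * x ^ n

ℕ→ℚ : ℕ → ℚ
ℕ→ℚ n = + n / 1

sumLt : ℕ → (ℕ → ℚ) → ℚ
sumLt zero    f = 0ℚ
sumLt (suc n) f = sumLt n f + f n

sumTo : ℕ → (ℕ → ℚ) → ℚ
sumTo n f = sumLt (suc n) f

stirling2 : ℕ → ℕ → ℕ
stirling2 zero    zero    = 1
stirling2 zero    (suc k) = 0
stirling2 (suc n) zero    = 0
stirling2 (suc n) (suc k) = suc k ℕ.* stirling2 n (suc k) ℕ.+ stirling2 n k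

harmonic : ℕ → ℚ
harmonic k = sumLt k (λ i → + 1 / suc i)

w : ℕ → ℚ → ℚ
w m x = sumTo m (λ k → ℕ→ℚ (stirling2 m k ℕ.* k !) * x ^ k)

-- harmonic geometric polynomial Hw_m(x) = Σ_{k=1}^m S(m,k) k! H_k x^k
-- (the k = 0 term would vanish anyway since H_0 = 0; we sum k = 1..m explicitly)
Hw : ℕ → ℚ → ℚ
Hw m x = sumLt m (λ j → ℕ→ℚ (stirling2 m (suc j) ℕ.* (suc j) !) * harmonic (suc j) * x ^ (suc j))

{-# OPTIONS --safe #-}
module Submission where

-- Put u = x(eᵗ − 1). A coefficient sequence c, read as a power series C(u) = Σ c_k u^k, is sent
-- to the exponential coefficients of C(x(eᵗ − 1)), namely Σ_k S(n,k) k! c_k x^k. Under this map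
-- 1/(1 − u) gives w, the harmonic series −ln(1 − u)/(1 − u) gives Hw, d/dt becomes a derivation
-- of the Cauchy product, and the Cauchy product becomes the binomial convolution (both are
-- multiplicative and obey the same Leibniz rule).
--
-- (i) The harmonic series is 1/(1 − u) times −ln(1 − u), so Hw = w ⊛ ℓ for the image ℓ of
-- −ln(1 − u), whose values are 0, x, (1 + x) w₁, (1 + x) w₂, …; differentiating once and
-- splitting off the two extreme terms of the convolution gives (i).
-- (ii) Since x eᵗ = x + u, the sum x Σₖ C(n,k) Hw_{k+1} is the n-th coefficient of the image of a
-- Cauchy product with x + u. One more derivative turns (ii) into a coefficientwise identity between
-- harmonic numbers, which follows from two instances of (k + 1) H_{k+1} = (k + 1) H_k + 1.

open import Defs
open import Data.Nat as ℕ using (ℕ; zero; suc; _≤_; _∸_; _<_; z≤n; s≤s; _!)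
import Data.Nat.Properties as ℕP
open import Data.Nat.Combinatorics
  using (_C_; nCk+nC[k+1]≡[n+1]C[k+1]; k>n⇒nCk≡0; nCk≡nC[n∸k]; nC1≡n)
open import Data.Nat.Tactic.RingSolver using (solve-∀)
import Data.Nat.Coprimality as Coprime
import Data.Integer as ℤ
import Data.Integer.Properties as ℤP
open import Data.Rational using (ℚ; 0ℚ; 1ℚ; mkℚ; _+_; _*_; _-_; -_; _÷_; 1/_; NonZero)
import Data.Rational.Properties as ℚP
open import Data.Rational.Solver using (module +-*-Solver)
open import Algebra.Properties.Group ℚP.+-0-group using (x∙y⁻¹≈ε⇒x≈y; x≈y⇒x∙y⁻¹≈ε)
open import Data.Product using (_×_; _,_)
open import Function using (_∘_; const)
open import Relation.Binary.PropositionalEquality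
open ≡-Reasoning

open +-*-Solver using (solve; _:=_; _:+_; _:*_; _:-_; con)

ℕ→ℚ≡mkℚ : ∀ n → ℕ→ℚ n ≡ mkℚ (ℤ.+ n) 0 (Coprime.sym (Coprime.1-coprimeTo n))
ℕ→ℚ≡mkℚ n = ℚP.normalize-coprime (Coprime.sym (Coprime.1-coprimeTo n))

ℕ→ℚ-+ : ∀ m n → ℕ→ℚ (m ℕ.+ n) ≡ ℕ→ℚ m + ℕ→ℚ n
ℕ→ℚ-+ m n rewrite ℕ→ℚ≡mkℚ m | ℕ→ℚ≡mkℚ n =
  ℚP./-cong (sym (cong₂ ℤ._+_ (ℤP.*-identityʳ (ℤ.+ m)) (ℤP.*-identityʳ (ℤ.+ n)))) refl

ℕ→ℚ-* : ∀ m n → ℕ→ℚ (m ℕ.* n) ≡ ℕ→ℚ m * ℕ→ℚ n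
ℕ→ℚ-* m n rewrite ℕ→ℚ≡mkℚ m | ℕ→ℚ≡mkℚ n = ℚP./-cong (ℤP.pos-* m n) refl

ℕ→ℚ-suc : ∀ n → ℕ→ℚ (suc n) ≡ 1ℚ + ℕ→ℚ n
ℕ→ℚ-suc = ℕ→ℚ-+ 1

ℕ→ℚ-suc-*-recip : ∀ n → ℕ→ℚ (suc n) * (ℤ.+ 1 Data.Rational./ suc n) ≡ 1ℚ
ℕ→ℚ-suc-*-recip n
  rewrite ℕ→ℚ≡mkℚ (suc n) | ℚP.normalize-coprime {1} {n} (Coprime.1-coprimeTo (suc n)) =
  ℚP.*-inverseʳ (mkℚ (ℤ.+ suc n) 0 (Coprime.sym (Coprime.1-coprimeTo (suc n))))

sumLt-cong : ∀ n {f g : ℕ → ℚ} → (∀ k → k < n → f k ≡ g k) → sumLt n f ≡ sumLt n g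
sumLt-cong zero    f≡g = refl
sumLt-cong (suc n) f≡g =
  cong₂ _+_ (sumLt-cong n (λ k k<n → f≡g k (ℕP.m<n⇒m<1+n k<n))) (f≡g n (ℕP.n<1+n n))

sumLt-+ : ∀ n (f g : ℕ → ℚ) → sumLt n (λ k → f k + g k) ≡ sumLt n f + sumLt n g
sumLt-+ zero    f g = refl
sumLt-+ (suc n) f g rewrite sumLt-+ n f g =
  solve 4 (λ a b c d → (a :+ b) :+ (c :+ d) := (a :+ c) :+ (b :+ d)) refl
    (sumLt n f) (sumLt n g) (f n) (g n)

*-sumLt : ∀ n c (f : ℕ → ℚ) → c * sumLt n f ≡ sumLt n (λ k → c * f k)
*-sumLt zero    c f = ℚP.*-zeroʳ c
*-sumLt (suc n) c f =
  trans (ℚP.*-distribˡ-+ c (sumLt n f) (f n)) (cong (_+ c * f n) (*-sumLt n c f))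

sumLt-+-* : ∀ n a (f g : ℕ → ℚ) → sumLt n (λ k → f k + a * g k) ≡ sumLt n f + a * sumLt n g
sumLt-+-* n a f g = trans (sumLt-+ n f _) (cong (sumLt n f +_) (sym (*-sumLt n a g)))

sumLt-suc : ∀ n (f : ℕ → ℚ) → sumLt (suc n) f ≡ f 0 + sumLt n (f ∘ suc)
sumLt-suc zero    f = ℚP.+-comm 0ℚ (f 0)
sumLt-suc (suc n) f rewrite sumLt-suc n f = ℚP.+-assoc (f 0) _ _

sumLt-zero : ∀ n (f : ℕ → ℚ) → (∀ k → k < n → f k ≡ 0ℚ) → sumLt n f ≡ 0ℚ
sumLt-zero n f f≡0 = trans (sumLt-cong n f≡0) (sumLt-const-0 n)
  where
  sumLt-const-0 : ∀ n → sumLt n (λ _ → 0ℚ) ≡ 0ℚ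
  sumLt-const-0 zero    = refl
  sumLt-const-0 (suc n) rewrite sumLt-const-0 n = refl

sumTo-weights : ∀ m (f : ℕ → ℚ) →
  sumTo m (λ i → ℕ→ℚ i * f i) + sumTo m (λ i → ℕ→ℚ (m ∸ i) * f i) ≡ ℕ→ℚ m * sumTo m f
sumTo-weights m f = begin
  sumTo m (λ i → ℕ→ℚ i * f i) + sumTo m (λ i → ℕ→ℚ (m ∸ i) * f i)
    ≡⟨ sym (sumLt-+ (suc m) _ _) ⟩
  sumTo m (λ i → ℕ→ℚ i * f i + ℕ→ℚ (m ∸ i) * f i)
    ≡⟨ sumLt-cong (suc m) (λ { i (s≤s i≤m) → weights-add-up i i≤m }) ⟩
  sumTo m (λ i → ℕ→ℚ m * f i)
    ≡⟨ sym (*-sumLt (suc m) (ℕ→ℚ m) f) ⟩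
  ℕ→ℚ m * sumTo m f ∎
  where
  weights-add-up : ∀ i → i ≤ m → ℕ→ℚ i * f i + ℕ→ℚ (m ∸ i) * f i ≡ ℕ→ℚ m * f i
  weights-add-up i i≤m = begin
    ℕ→ℚ i * f i + ℕ→ℚ (m ∸ i) * f i  ≡⟨ sym (ℚP.*-distribʳ-+ (f i) (ℕ→ℚ i) (ℕ→ℚ (m ∸ i))) ⟩
    (ℕ→ℚ i + ℕ→ℚ (m ∸ i)) * f i      ≡⟨ cong (_* f i) (sym (ℕ→ℚ-+ i (m ∸ i))) ⟩
    ℕ→ℚ (i ℕ.+ (m ∸ i)) * f i        ≡⟨ cong (λ k → ℕ→ℚ k * f i) (ℕP.m+[n∸m]≡n i≤m) ⟩
    ℕ→ℚ m * f i ∎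

[n+1]Cn≡n+1 : ∀ n → suc n C n ≡ suc n
[n+1]Cn≡n+1 n =
  trans (nCk≡nC[n∸k] (ℕP.n≤1+n n)) (trans (cong (suc n C_) (ℕP.m+n∸n≡m 1 n)) (nC1≡n (suc n)))

[1+n]∸k≡2+[n∸[1+k]] : ∀ {k n} → k < n → suc n ∸ k ≡ suc (suc (n ∸ suc k))
[1+n]∸k≡2+[n∸[1+k]] k<n = trans (ℕP.+-∸-assoc 1 (ℕP.<⇒≤ k<n)) (cong suc (ℕP.+-∸-assoc 1 k<n))

surjections : ℕ → ℕ → ℕ
surjections n k = stirling2 n k ℕ.* k !

surjections-suc : ∀ n k →
  surjections (suc n) (suc k) ≡ suc k ℕ.* surjections n (suc k) ℕ.+ suc k ℕ.* surjections n k
surjections-suc n k = regroup (suc k) (stirling2 n (suc k)) (stirling2 n k) (k !)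
  where
  regroup : ∀ s a b f →
    (s ℕ.* a ℕ.+ b) ℕ.* (s ℕ.* f) ≡ s ℕ.* (a ℕ.* (s ℕ.* f)) ℕ.+ s ℕ.* (b ℕ.* f)
  regroup = solve-∀

stirling2-above : ∀ n k → n < k → stirling2 n k ≡ 0
stirling2-above zero    (suc k) _ = refl
stirling2-above (suc n) (suc k) (s≤s n<k)
  rewrite stirling2-above n (suc k) (ℕP.m<n⇒m<1+n n<k) | stirling2-above n k n<k | ℕP.*-zeroʳ k = refl

surjℚ : ℕ → ℕ → ℚ
surjℚ n k = ℕ→ℚ (surjections n k)

surjℚ-suc : ∀ n k →
  surjℚ (suc n) (suc k) ≡ ℕ→ℚ (suc k) * surjℚ n (suc k) + ℕ→ℚ (suc k) * surjℚ n k
surjℚ-suc n k = begin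
  ℕ→ℚ (surjections (suc n) (suc k))
    ≡⟨ cong ℕ→ℚ (surjections-suc n k) ⟩
  ℕ→ℚ (suc k ℕ.* surjections n (suc k) ℕ.+ suc k ℕ.* surjections n k)
    ≡⟨ ℕ→ℚ-+ (suc k ℕ.* surjections n (suc k)) (suc k ℕ.* surjections n k) ⟩
  ℕ→ℚ (suc k ℕ.* surjections n (suc k)) + ℕ→ℚ (suc k ℕ.* surjections n k)
    ≡⟨ cong₂ _+_ (ℕ→ℚ-* (suc k) (surjections n (suc k))) (ℕ→ℚ-* (suc k) (surjections n k)) ⟩
  ℕ→ℚ (suc k) * surjℚ n (suc k) + ℕ→ℚ (suc k) * surjℚ n k ∎

surjℚ-above : ∀ n k → n < k → surjℚ n k ≡ 0ℚ
surjℚ-above n k n<k = cong (λ s → ℕ→ℚ (s ℕ.* k !)) (stirling2-above n k n<k)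

_⋆_ : (ℕ → ℚ) → (ℕ → ℚ) → ℕ → ℚ
(c ⋆ d) j = sumTo j (λ i → c i * d (j ∸ i))

weighted-⋆ : (ℕ → ℚ) → (ℕ → ℚ) → (ℕ → ℚ) → ℕ → ℚ
weighted-⋆ ω c d j = sumTo j (λ i → ω i * (c i * d (j ∸ i)))

const1⋆-zero : ∀ f → (const 1ℚ ⋆ f) 0 ≡ f 0
const1⋆-zero f = solve 1 (λ a → con 0ℚ :+ con 1ℚ :* a := a) refl (f 0)

const1⋆-suc : ∀ f j → (const 1ℚ ⋆ f) (suc j) ≡ f (suc j) + (const 1ℚ ⋆ f) j
const1⋆-suc f j =
  trans (sumLt-suc (suc j) _) (cong (_+ (const 1ℚ ⋆ f) j) (ℚP.*-identityˡ (f (suc j))))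

_⊛_ : (ℕ → ℚ) → (ℕ → ℚ) → ℕ → ℚ
(a ⊛ b) n = sumTo n (λ k → ℕ→ℚ (n C k) * a k * b (n ∸ k))

⊛-cong : ∀ {a a′ b b′ : ℕ → ℚ} → (∀ k → a k ≡ a′ k) → (∀ k → b k ≡ b′ k) →
         ∀ n → (a ⊛ b) n ≡ (a′ ⊛ b′) n
⊛-cong a≡a′ b≡b′ n =
  sumLt-cong (suc n) (λ k _ → cong₂ (λ u v → ℕ→ℚ (n C k) * u * v) (a≡a′ k) (b≡b′ (n ∸ k)))

⊛-suc : ∀ (a b : ℕ → ℚ) n → (a ⊛ b) (suc n) ≡ ((a ∘ suc) ⊛ b) n + (a ⊛ (b ∘ suc)) n
⊛-suc a b n = begin
  (a ⊛ b) (suc n)                             ≡⟨ sumLt-suc (suc n) _ ⟩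
  head + sumLt (suc n) _                      ≡⟨ cong (head +_) (sumLt-cong (suc n) (λ k _ → pascal k)) ⟩
  head + sumLt (suc n) (λ k → F k + G k)      ≡⟨ cong (head +_) (sumLt-+ (suc n) F G) ⟩
  head + (sumLt (suc n) F + sumLt (suc n) G)  ≡⟨ cong (λ t → head + (sumLt (suc n) F + t)) G-last ⟩
  head + (sumLt (suc n) F + sumLt n G)
    ≡⟨ solve 3 (λ h f g → h :+ (f :+ g) := f :+ (h :+ g)) refl head (sumLt (suc n) F) (sumLt n G) ⟩
  sumLt (suc n) F + (head + sumLt n G)        ≡⟨ cong (λ t → sumLt (suc n) F + (head + t)) G-shift ⟩
  ((a ∘ suc) ⊛ b) n + (head + sumLt n _)      ≡⟨ cong (((a ∘ suc) ⊛ b) n +_) (sym (sumLt-suc n _)) ⟩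
  ((a ∘ suc) ⊛ b) n + (a ⊛ (b ∘ suc)) n       ∎
  where
  head : ℚ
  head = ℕ→ℚ 1 * a 0 * b (suc n)
  F G : ℕ → ℚ
  F k = ℕ→ℚ (n C k) * a (suc k) * b (n ∸ k)
  G k = ℕ→ℚ (n C suc k) * a (suc k) * b (n ∸ k)
  pascal : ∀ k → ℕ→ℚ (suc n C suc k) * a (suc k) * b (n ∸ k) ≡ F k + G k
  pascal k = begin
    ℕ→ℚ (suc n C suc k) * a (suc k) * b (n ∸ k)
      ≡⟨ cong (λ m → ℕ→ℚ m * a (suc k) * b (n ∸ k)) (sym (nCk+nC[k+1]≡[n+1]C[k+1] n k)) ⟩
    ℕ→ℚ (n C k ℕ.+ n C suc k) * a (suc k) * b (n ∸ k)
      ≡⟨ cong (λ q → q * a (suc k) * b (n ∸ k)) (ℕ→ℚ-+ (n C k) (n C suc k)) ⟩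
    (ℕ→ℚ (n C k) + ℕ→ℚ (n C suc k)) * a (suc k) * b (n ∸ k)
      ≡⟨ solve 4 (λ p q u v → (p :+ q) :* u :* v := p :* u :* v :+ q :* u :* v) refl
           (ℕ→ℚ (n C k)) (ℕ→ℚ (n C suc k)) (a (suc k)) (b (n ∸ k)) ⟩
    F k + G k ∎
  G-last : sumLt (suc n) G ≡ sumLt n G
  G-last = begin
    sumLt n G + G n
      ≡⟨ cong (λ m → sumLt n G + ℕ→ℚ m * a (suc n) * b (n ∸ n)) (k>n⇒nCk≡0 (ℕP.n<1+n n)) ⟩
    sumLt n G + 0ℚ * a (suc n) * b (n ∸ n)
      ≡⟨ solve 3 (λ s u v → s :+ con 0ℚ :* u :* v := s) refl (sumLt n G) (a (suc n)) (b (n ∸ n)) ⟩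
    sumLt n G ∎
  G-shift : sumLt n G ≡ sumLt n (λ k → ℕ→ℚ (n C suc k) * a (suc k) * b (suc (n ∸ suc k)))
  G-shift = sumLt-cong n (λ k k<n → cong (λ m → ℕ→ℚ (n C suc k) * a (suc k) * b m) (ℕP.+-∸-assoc 1 k<n))

recip : ℕ → ℚ
recip zero    = 0ℚ
recip (suc k) = ℤ.+ 1 Data.Rational./ suc k

harmonic≡const1⋆recip : ∀ j → harmonic j ≡ (const 1ℚ ⋆ recip) j
harmonic≡const1⋆recip zero    = sym (const1⋆-zero recip)
harmonic≡const1⋆recip (suc j) = begin
  harmonic j + recip (suc j)                ≡⟨ cong (_+ recip (suc j)) (harmonic≡const1⋆recip j) ⟩
  (const 1ℚ ⋆ recip) j + recip (suc j)      ≡⟨ ℚP.+-comm _ (recip (suc j)) ⟩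
  recip (suc j) + (const 1ℚ ⋆ recip) j      ≡⟨ sym (const1⋆-suc recip j) ⟩
  (const 1ℚ ⋆ recip) (suc j) ∎

harmonic-suc : ∀ j → ℕ→ℚ (suc j) * harmonic (suc j) ≡ ℕ→ℚ (suc j) * harmonic j + 1ℚ
harmonic-suc j = trans (ℚP.*-distribˡ-+ (ℕ→ℚ (suc j)) (harmonic j) _)
                       (cong (ℕ→ℚ (suc j) * harmonic j +_) (ℕ→ℚ-suc-*-recip j))

harmonic-key : ∀ n x h₀ h₁ h₂ {a b c p₀ p₁ p₂ : ℚ} →
  a ≡ 1ℚ + n → b ≡ 1ℚ + a → c ≡ 1ℚ + b →
  p₀ ≡ (n + x * a) * h₀ + x → p₁ ≡ (a + x * b) * h₁ + x → p₂ ≡ (b + x * c) * h₂ + x →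
  a * h₁ ≡ a * h₀ + 1ℚ → b * h₂ ≡ b * h₁ + 1ℚ →
  a * (p₀ + x * p₁) + x * (b * (p₁ + x * p₂)) ≡
    (1ℚ + x) * ((a * p₁ + x * (b * p₂)) - p₁ - (a * 1ℚ + x * (b * 1ℚ)) + 1ℚ)
harmonic-key n x h₀ h₁ h₂ refl refl refl refl refl refl step₁ step₂ =
  x∙y⁻¹≈ε⇒x≈y _ _ (trans
    -- LHS − RHS = α (a h₀ + 1 − a h₁) − β (b h₂ − b h₁ − 1), which step₁ and step₂ make 0
    (solve 5 (λ n x h₀ h₁ h₂ →
      let ı = con 1ℚ
          a = ı :+ n
          b = ı :+ a
          c = ı :+ b
          p₀ = (n :+ x :* a) :* h₀ :+ x
          p₁ = (a :+ x :* b) :* h₁ :+ x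
          p₂ = (b :+ x :* c) :* h₂ :+ x
      in (a :* (p₀ :+ x :* p₁) :+ x :* (b :* (p₁ :+ x :* p₂)))
           :- ((ı :+ x) :* ((a :* p₁ :+ x :* (b :* p₂)) :- p₁ :- (a :* ı :+ x :* (b :* ı)) :+ ı))
         := (n :+ x :* a) :* ((a :* h₀ :+ ı) :- a :* h₁)
           :- (x :* (b :+ x :* c)) :* (b :* h₂ :- (b :* h₁ :+ ı)))
      refl n x h₀ h₁ h₂)
    (trans (cong₂ (λ u v → α * u - β * v) (x≈y⇒x∙y⁻¹≈ε (sym step₁)) (x≈y⇒x∙y⁻¹≈ε step₂))
           (solve 2 (λ a b → a :* con 0ℚ :- b :* con 0ℚ := con 0ℚ) refl α β)))
  where
  α β : ℚ
  α = n + x * (1ℚ + n)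
  β = x * ((1ℚ + (1ℚ + n)) + x * (1ℚ + (1ℚ + (1ℚ + n))))

*≡*⇒÷*≡ : ∀ a b s r .{{_ : NonZero b}} → a * s ≡ b * r → (a ÷ b) * s ≡ r
*≡*⇒÷*≡ a b s r as≡br = begin
  (a * 1/ b) * s   ≡⟨ solve 3 (λ a i s → (a :* i) :* s := i :* (a :* s)) refl a (1/ b) s ⟩
  1/ b * (a * s)   ≡⟨ cong (1/ b *_) as≡br ⟩
  1/ b * (b * r)   ≡⟨ sym (ℚP.*-assoc (1/ b) b r) ⟩
  (1/ b * b) * r   ≡⟨ cong (_* r) (ℚP.*-inverseˡ b) ⟩
  1ℚ * r           ≡⟨ ℚP.*-identityˡ r ⟩
  r ∎

module GeometricTransform (x : ℚ) where

  geom : (ℕ → ℚ) → ℕ → ℚ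
  geom c n = sumTo n (λ k → surjℚ n k * c k * x ^ k)

  -- d/dt on C(x(eᵗ − 1)), i.e. C(u) ↦ (x + u) C′(u), read on coefficients.
  ∂ : (ℕ → ℚ) → ℕ → ℚ
  ∂ c j = ℕ→ℚ j * c j + x * (ℕ→ℚ (suc j) * c (suc j))

  geom-cong : ∀ {c d : ℕ → ℚ} → (∀ k → c k ≡ d k) → ∀ n → geom c n ≡ geom d n
  geom-cong c≡d n = sumLt-cong (suc n) (λ k _ → cong (λ t → surjℚ n k * t * x ^ k) (c≡d k))

  geom-zero : ∀ c → geom c 0 ≡ c 0
  geom-zero c = solve 1 (λ a → con 0ℚ :+ con 1ℚ :* a :* con 1ℚ := a) refl (c 0)

  geom-suc-tail : ∀ c n →
    geom c (suc n) ≡ sumLt (suc n) (λ k → surjℚ (suc n) (suc k) * c (suc k) * x ^ suc k)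
  geom-suc-tail c n = begin
    geom c (suc n)      ≡⟨ sumLt-suc (suc n) _ ⟩
    0ℚ * c 0 * 1ℚ + T   ≡⟨ cong (_+ T) (solve 1 (λ a → con 0ℚ :* a :* con 1ℚ := con 0ℚ) refl (c 0)) ⟩
    0ℚ + T              ≡⟨ ℚP.+-identityˡ T ⟩
    T ∎
    where
    T : ℚ
    T = sumLt (suc n) (λ k → surjℚ (suc n) (suc k) * c (suc k) * x ^ suc k)

  geom-suc-cong : ∀ {c d : ℕ → ℚ} → (∀ k → c (suc k) ≡ d (suc k)) →
                  ∀ n → geom c (suc n) ≡ geom d (suc n)
  geom-suc-cong {c} {d} c≡d n = trans (geom-suc-tail c n) (trans
    (sumLt-cong (suc n) (λ k _ → cong (λ t → surjℚ (suc n) (suc k) * t * x ^ suc k) (c≡d k)))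
    (sym (geom-suc-tail d n)))

  geom-+ : ∀ (c d : ℕ → ℚ) n → geom (λ k → c k + d k) n ≡ geom c n + geom d n
  geom-+ c d n = trans (sumLt-cong (suc n) (λ k _ → distrib k)) (sumLt-+ (suc n) _ _)
    where
    distrib : ∀ k → surjℚ n k * (c k + d k) * x ^ k ≡ surjℚ n k * c k * x ^ k + surjℚ n k * d k * x ^ k
    distrib k = solve 4 (λ s a b y → s :* (a :+ b) :* y := s :* a :* y :+ s :* b :* y) refl
      (surjℚ n k) (c k) (d k) (x ^ k)

  geom-* : ∀ α (c : ℕ → ℚ) n → geom (λ k → α * c k) n ≡ α * geom c n
  geom-* α c n = trans (sumLt-cong (suc n) (λ k _ → pull k)) (sym (*-sumLt (suc n) α _))
    where
    pull : ∀ k → surjℚ n k * (α * c k) * x ^ k ≡ α * (surjℚ n k * c k * x ^ k)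
    pull k = solve 4 (λ s a b y → s :* (a :* b) :* y := a :* (s :* b :* y)) refl
      (surjℚ n k) α (c k) (x ^ k)

  geom-- : ∀ (c d : ℕ → ℚ) n → geom (λ k → c k - d k) n ≡ geom c n - geom d n
  geom-- c d n = begin
    geom (λ k → c k - d k) n
      ≡⟨ geom-cong (λ k → solve 2 (λ a b → a :- b := a :+ con (- 1ℚ) :* b) refl (c k) (d k)) n ⟩
    geom (λ k → c k + (- 1ℚ) * d k) n
      ≡⟨ geom-+ c _ n ⟩
    geom c n + geom (λ k → (- 1ℚ) * d k) n
      ≡⟨ cong (geom c n +_) (geom-* (- 1ℚ) d n) ⟩
    geom c n + (- 1ℚ) * geom d n
      ≡⟨ solve 2 (λ a b → a :+ con (- 1ℚ) :* b := a :- b) refl (geom c n) (geom d n) ⟩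
    geom c n - geom d n ∎

  geom-suc : ∀ c n → geom c (suc n) ≡ geom (∂ c) n
  geom-suc c n = begin
    geom c (suc n)                     ≡⟨ geom-suc-tail c n ⟩
    sumLt (suc n) _                    ≡⟨ sumLt-cong (suc n) (λ k _ → split k) ⟩
    sumLt (suc n) (λ k → P k + Q k)    ≡⟨ sumLt-+ (suc n) P Q ⟩
    sumLt (suc n) P + sumLt (suc n) Q  ≡⟨ cong (_+ sumLt (suc n) Q) P≡R ⟩
    sumLt (suc n) R + sumLt (suc n) Q  ≡⟨ sym (sumLt-+ (suc n) R Q) ⟩
    sumLt (suc n) (λ k → R k + Q k)    ≡⟨ sumLt-cong (suc n) (λ k _ → merge k) ⟩
    geom (∂ c) n ∎
    where
    P Q R : ℕ → ℚ
    P k = ℕ→ℚ (suc k) * surjℚ n (suc k) * c (suc k) * x ^ suc k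
    Q k = ℕ→ℚ (suc k) * surjℚ n k * c (suc k) * x ^ suc k
    R k = ℕ→ℚ k * surjℚ n k * c k * x ^ k
    split : ∀ k → surjℚ (suc n) (suc k) * c (suc k) * x ^ suc k ≡ P k + Q k
    split k = trans (cong (λ t → t * c (suc k) * x ^ suc k) (surjℚ-suc n k))
      (solve 5 (λ s a b e y → (s :* a :+ s :* b) :* e :* y := s :* a :* e :* y :+ s :* b :* e :* y) refl
        (ℕ→ℚ (suc k)) (surjℚ n (suc k)) (surjℚ n k) (c (suc k)) (x ^ suc k))
    P≡R : sumLt (suc n) P ≡ sumLt (suc n) R
    P≡R = begin
      sumLt n P + P n
        ≡⟨ cong (λ t → sumLt n P + ℕ→ℚ (suc n) * t * c (suc n) * x ^ suc n)
                (surjℚ-above n (suc n) (ℕP.n<1+n n)) ⟩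
      sumLt n P + ℕ→ℚ (suc n) * 0ℚ * c (suc n) * x ^ suc n
        ≡⟨ solve 6 (λ s a b y t e → s :+ a :* con 0ℚ :* b :* y := con 0ℚ :* t :* e :* con 1ℚ :+ s) refl
             (sumLt n P) (ℕ→ℚ (suc n)) (c (suc n)) (x ^ suc n) (surjℚ n 0) (c 0) ⟩
      R 0 + sumLt n P
        ≡⟨ sym (sumLt-suc n R) ⟩
      sumLt (suc n) R ∎
    merge : ∀ k → R k + Q k ≡ surjℚ n k * ∂ c k * x ^ k
    merge k =
      solve 7 (λ m m′ s a a′ z y → m :* s :* a :* y :+ m′ :* s :* a′ :* (z :* y)
                                  := s :* (m :* a :+ z :* (m′ :* a′)) :* y) refl
        (ℕ→ℚ k) (ℕ→ℚ (suc k)) (surjℚ n k) (c k) (c (suc k)) x (x ^ k)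

  ∂ˡ-⋆ : ∀ c d j → (∂ c ⋆ d) j ≡ weighted-⋆ ℕ→ℚ c d j + x * weighted-⋆ ℕ→ℚ c d (suc j)
  ∂ˡ-⋆ c d j = begin
    (∂ c ⋆ d) j
      ≡⟨ sumLt-cong (suc j) (λ i _ → expand i) ⟩
    sumTo j (λ i → ℕ→ℚ i * (c i * d (j ∸ i)) + x * B i)
      ≡⟨ sumLt-+-* (suc j) x _ B ⟩
    weighted-⋆ ℕ→ℚ c d j + x * sumTo j B
      ≡⟨ cong (λ t → weighted-⋆ ℕ→ℚ c d j + x * t) shift ⟩
    weighted-⋆ ℕ→ℚ c d j + x * weighted-⋆ ℕ→ℚ c d (suc j) ∎
    where
    B : ℕ → ℚ
    B i = ℕ→ℚ (suc i) * (c (suc i) * d (j ∸ i))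
    expand : ∀ i → ∂ c i * d (j ∸ i) ≡ ℕ→ℚ i * (c i * d (j ∸ i)) + x * B i
    expand i =
      solve 6 (λ y m m′ a a′ b → (m :* a :+ y :* (m′ :* a′)) :* b := m :* (a :* b) :+ y :* (m′ :* (a′ :* b)))
        refl x (ℕ→ℚ i) (ℕ→ℚ (suc i)) (c i) (c (suc i)) (d (j ∸ i))
    shift : sumTo j B ≡ weighted-⋆ ℕ→ℚ c d (suc j)
    shift = sym (trans (sumLt-suc (suc j) _)
                       (trans (cong (_+ sumTo j B) (ℚP.*-zeroˡ (c 0 * d (suc j)))) (ℚP.+-identityˡ _)))

  ∂ʳ-⋆ : ∀ c d j → (c ⋆ ∂ d) j ≡
    weighted-⋆ (λ i → ℕ→ℚ (j ∸ i)) c d j + x * weighted-⋆ (λ i → ℕ→ℚ (suc j ∸ i)) c d (suc j)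
  ∂ʳ-⋆ c d j = begin
    (c ⋆ ∂ d) j
      ≡⟨ sumLt-cong (suc j) (λ { i (s≤s i≤j) → expand i i≤j }) ⟩
    sumTo j (λ i → ℕ→ℚ (j ∸ i) * (c i * d (j ∸ i)) + x * B i)
      ≡⟨ sumLt-+-* (suc j) x _ B ⟩
    weighted-⋆ (λ i → ℕ→ℚ (j ∸ i)) c d j + x * sumTo j B
      ≡⟨ cong (λ t → weighted-⋆ (λ i → ℕ→ℚ (j ∸ i)) c d j + x * t) extend ⟩
    weighted-⋆ (λ i → ℕ→ℚ (j ∸ i)) c d j + x * weighted-⋆ (λ i → ℕ→ℚ (suc j ∸ i)) c d (suc j) ∎
    where
    B : ℕ → ℚ
    B i = ℕ→ℚ (suc j ∸ i) * (c i * d (suc j ∸ i))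
    expand : ∀ i → i ≤ j → c i * ∂ d (j ∸ i) ≡ ℕ→ℚ (j ∸ i) * (c i * d (j ∸ i)) + x * B i
    expand i i≤j = begin
      c i * (ℕ→ℚ (j ∸ i) * d (j ∸ i) + x * (ℕ→ℚ (suc (j ∸ i)) * d (suc (j ∸ i))))
        ≡⟨ cong (λ m → c i * (ℕ→ℚ (j ∸ i) * d (j ∸ i) + x * (ℕ→ℚ m * d m)))
                (sym (ℕP.+-∸-assoc 1 i≤j)) ⟩
      c i * (ℕ→ℚ (j ∸ i) * d (j ∸ i) + x * (ℕ→ℚ (suc j ∸ i) * d (suc j ∸ i)))
        ≡⟨ solve 6 (λ y a m b m′ b′ → a :* (m :* b :+ y :* (m′ :* b′))
                                     := m :* (a :* b) :+ y :* (m′ :* (a :* b′)))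
             refl x (c i) (ℕ→ℚ (j ∸ i)) (d (j ∸ i)) (ℕ→ℚ (suc j ∸ i)) (d (suc j ∸ i)) ⟩
      ℕ→ℚ (j ∸ i) * (c i * d (j ∸ i)) + x * B i ∎
    extend : sumTo j B ≡ weighted-⋆ (λ i → ℕ→ℚ (suc j ∸ i)) c d (suc j)
    extend = sym (begin
      sumTo j B + ℕ→ℚ (j ∸ j) * T ≡⟨ cong (λ m → sumTo j B + ℕ→ℚ m * T) (ℕP.n∸n≡0 j) ⟩
      sumTo j B + 0ℚ * T          ≡⟨ cong (sumTo j B +_) (ℚP.*-zeroˡ T) ⟩
      sumTo j B + 0ℚ              ≡⟨ ℚP.+-identityʳ (sumTo j B) ⟩
      sumTo j B ∎)
      where
      T : ℚ
      T = c (suc j) * d (j ∸ j)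

  ∂-⋆ : ∀ c d j → ∂ (c ⋆ d) j ≡ (∂ c ⋆ d) j + (c ⋆ ∂ d) j
  ∂-⋆ c d j = sym (begin
    (∂ c ⋆ d) j + (c ⋆ ∂ d) j
      ≡⟨ cong₂ _+_ (∂ˡ-⋆ c d j) (∂ʳ-⋆ c d j) ⟩
    (A + x * B) + (A′ + x * B′)
      ≡⟨ solve 5 (λ a b a′ b′ y → (a :+ y :* b) :+ (a′ :+ y :* b′) := (a :+ a′) :+ y :* (b :+ b′))
           refl A B A′ B′ x ⟩
    (A + A′) + x * (B + B′)
      ≡⟨ cong₂ (λ u v → u + x * v) (sumTo-weights j (λ i → c i * d (j ∸ i)))
                                   (sumTo-weights (suc j) (λ i → c i * d (suc j ∸ i))) ⟩
    ∂ (c ⋆ d) j ∎)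
    where
    A B A′ B′ : ℚ
    A  = weighted-⋆ ℕ→ℚ c d j
    B  = weighted-⋆ ℕ→ℚ c d (suc j)
    A′ = weighted-⋆ (λ i → ℕ→ℚ (j ∸ i)) c d j
    B′ = weighted-⋆ (λ i → ℕ→ℚ (suc j ∸ i)) c d (suc j)

  geom-⋆ : ∀ n (c d : ℕ → ℚ) → geom (c ⋆ d) n ≡ (geom c ⊛ geom d) n
  geom-⋆ zero c d = begin
    geom (c ⋆ d) 0           ≡⟨ geom-zero (c ⋆ d) ⟩
    0ℚ + c 0 * d 0           ≡⟨ cong₂ (λ u v → 0ℚ + u * v) (sym (geom-zero c)) (sym (geom-zero d)) ⟩
    0ℚ + geom c 0 * geom d 0 ≡⟨ solve 2 (λ a b → con 0ℚ :+ a :* b := con 0ℚ :+ con 1ℚ :* a :* b) refl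
                                  (geom c 0) (geom d 0) ⟩
    (geom c ⊛ geom d) 0 ∎
  geom-⋆ (suc n) c d = begin
    geom (c ⋆ d) (suc n)                                      ≡⟨ geom-suc (c ⋆ d) n ⟩
    geom (∂ (c ⋆ d)) n                                        ≡⟨ geom-cong (∂-⋆ c d) n ⟩
    geom (λ k → (∂ c ⋆ d) k + (c ⋆ ∂ d) k) n                  ≡⟨ geom-+ (∂ c ⋆ d) (c ⋆ ∂ d) n ⟩
    geom (∂ c ⋆ d) n + geom (c ⋆ ∂ d) n
      ≡⟨ cong₂ _+_ (geom-⋆ n (∂ c) d) (geom-⋆ n c (∂ d)) ⟩
    (geom (∂ c) ⊛ geom d) n + (geom c ⊛ geom (∂ d)) n
      ≡⟨ sym (cong₂ _+_ (⊛-cong {b = geom d} (geom-suc c) (λ _ → refl) n)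
                        (⊛-cong {a = geom c} (λ _ → refl) (geom-suc d) n)) ⟩
    ((geom c ∘ suc) ⊛ geom d) n + (geom c ⊛ (geom d ∘ suc)) n ≡⟨ sym (⊛-suc (geom c) (geom d) n) ⟩
    (geom c ⊛ geom d) (suc n) ∎

  w≡geom-const1 : ∀ m → w m x ≡ geom (const 1ℚ) m
  w≡geom-const1 m = sumLt-cong (suc m) (λ k _ → cong (_* x ^ k) (sym (ℚP.*-identityʳ (surjℚ m k))))

  Hw≡geom-harmonic : ∀ m → Hw m x ≡ geom harmonic m
  Hw≡geom-harmonic m = sym (begin
    geom harmonic m
      ≡⟨ sumLt-suc m _ ⟩
    surjℚ m 0 * 0ℚ * 1ℚ + Hw m x
      ≡⟨ cong (_+ Hw m x) (solve 1 (λ s → s :* con 0ℚ :* con 1ℚ := con 0ℚ) refl (surjℚ m 0)) ⟩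
    0ℚ + Hw m x
      ≡⟨ ℚP.+-identityˡ (Hw m x) ⟩
    Hw m x ∎)

  ∂recip-zero : ∂ recip 0 ≡ x
  ∂recip-zero = solve 1 (λ y → con 0ℚ :* con 0ℚ :+ y :* (con 1ℚ :* con 1ℚ) := y) refl x

  ∂recip-suc : ∀ k → ∂ recip (suc k) ≡ 1ℚ + x
  ∂recip-suc k = cong₂ _+_ (ℕ→ℚ-suc-*-recip k)
                           (trans (cong (x *_) (ℕ→ℚ-suc-*-recip (suc k))) (ℚP.*-identityʳ x))

  const1⋆∂recip : ∀ j → (const 1ℚ ⋆ ∂ recip) j ≡ ∂ (const 1ℚ) j
  const1⋆∂recip zero = trans (const1⋆-zero (∂ recip)) (trans ∂recip-zero
    (solve 1 (λ y → y := con 0ℚ :* con 1ℚ :+ y :* (con 1ℚ :* con 1ℚ)) refl x))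
  const1⋆∂recip (suc j) = begin
    (const 1ℚ ⋆ ∂ recip) (suc j)
      ≡⟨ const1⋆-suc (∂ recip) j ⟩
    ∂ recip (suc j) + (const 1ℚ ⋆ ∂ recip) j
      ≡⟨ cong₂ _+_ (∂recip-suc j) (const1⋆∂recip j) ⟩
    (1ℚ + x) + (ℕ→ℚ j * 1ℚ + x * (ℕ→ℚ (suc j) * 1ℚ))
      ≡⟨ solve 3 (λ n s y → (con 1ℚ :+ y) :+ (n :* con 1ℚ :+ y :* (s :* con 1ℚ))
                         := (con 1ℚ :+ n) :* con 1ℚ :+ y :* ((con 1ℚ :+ s) :* con 1ℚ))
           refl (ℕ→ℚ j) (ℕ→ℚ (suc j)) x ⟩
    (1ℚ + ℕ→ℚ j) * 1ℚ + x * ((1ℚ + ℕ→ℚ (suc j)) * 1ℚ)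
      ≡⟨ sym (cong₂ (λ u v → u * 1ℚ + x * (v * 1ℚ)) (ℕ→ℚ-suc j) (ℕ→ℚ-suc (suc j))) ⟩
    ∂ (const 1ℚ) (suc j) ∎

  ℓ : ℕ → ℚ
  ℓ = geom recip

  ℓ-zero : ℓ 0 ≡ 0ℚ
  ℓ-zero = geom-zero recip

  ℓ-one : ℓ 1 ≡ x
  ℓ-one = trans (geom-suc recip 0) (trans (geom-zero (∂ recip)) ∂recip-zero)

  ℓ-suc-suc : ∀ q → ℓ (suc (suc q)) ≡ (1ℚ + x) * w (suc q) x
  ℓ-suc-suc q = begin
    ℓ (suc (suc q))
      ≡⟨ geom-suc recip (suc q) ⟩
    geom (∂ recip) (suc q)
      ≡⟨ geom-suc-cong (λ k → trans (∂recip-suc k) (sym (ℚP.*-identityʳ (1ℚ + x)))) q ⟩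
    geom (λ k → (1ℚ + x) * 1ℚ) (suc q)
      ≡⟨ geom-* (1ℚ + x) (const 1ℚ) (suc q) ⟩
    (1ℚ + x) * geom (const 1ℚ) (suc q)
      ≡⟨ cong ((1ℚ + x) *_) (sym (w≡geom-const1 (suc q))) ⟩
    (1ℚ + x) * w (suc q) x ∎

  wₓ : ℕ → ℚ
  wₓ m = w m x

  Hw≡wₓ⊛ℓ : ∀ m → Hw m x ≡ (wₓ ⊛ ℓ) m
  Hw≡wₓ⊛ℓ m = begin
    Hw m x                     ≡⟨ Hw≡geom-harmonic m ⟩
    geom harmonic m            ≡⟨ geom-cong harmonic≡const1⋆recip m ⟩
    geom (const 1ℚ ⋆ recip) m  ≡⟨ geom-⋆ m (const 1ℚ) recip ⟩
    (geom (const 1ℚ) ⊛ ℓ) m    ≡⟨ ⊛-cong {b = ℓ} (sym ∘ w≡geom-const1) (λ _ → refl) m ⟩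
    (wₓ ⊛ ℓ) m ∎

  wₓ⊛ℓ∘suc : ∀ m → (wₓ ⊛ (ℓ ∘ suc)) m ≡ wₓ (suc m)
  wₓ⊛ℓ∘suc m = begin
    (wₓ ⊛ (ℓ ∘ suc)) m                     ≡⟨ ⊛-cong w≡geom-const1 (geom-suc recip) m ⟩
    (geom (const 1ℚ) ⊛ geom (∂ recip)) m   ≡⟨ sym (geom-⋆ m (const 1ℚ) (∂ recip)) ⟩
    geom (const 1ℚ ⋆ ∂ recip) m            ≡⟨ geom-cong const1⋆∂recip m ⟩
    geom (∂ (const 1ℚ)) m                  ≡⟨ sym (geom-suc (const 1ℚ) m) ⟩
    geom (const 1ℚ) (suc m)                ≡⟨ sym (w≡geom-const1 (suc m)) ⟩
    wₓ (suc m) ∎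

  wₓ∘suc⊛ℓ : ∀ m → ((wₓ ∘ suc) ⊛ ℓ) m ≡
    ℕ→ℚ m * x * wₓ m
      + (1ℚ + x) * sumLt (m ∸ 1) (λ k → ℕ→ℚ (m C k) * wₓ (m ∸ k ∸ 1) * wₓ (suc k))
  wₓ∘suc⊛ℓ zero = begin
    0ℚ + 1ℚ * wₓ 1 * ℓ 0           ≡⟨ cong (λ t → 0ℚ + 1ℚ * wₓ 1 * t) ℓ-zero ⟩
    0ℚ + 1ℚ * wₓ 1 * 0ℚ            ≡⟨ solve 3 (λ a b y → con 0ℚ :+ con 1ℚ :* a :* con 0ℚ
                                                     := con 0ℚ :* y :* b :+ (con 1ℚ :+ y) :* con 0ℚ)
                                         refl (wₓ 1) (wₓ 0) x ⟩
    0ℚ * x * wₓ 0 + (1ℚ + x) * 0ℚ ∎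
  wₓ∘suc⊛ℓ (suc p) = begin
    (sumLt p F + F p) + F (suc p)
      ≡⟨ cong₂ _+_ (cong₂ _+_ off-diagonal diagonal) corner ⟩
    ((1ℚ + x) * Σ + ℕ→ℚ (suc p) * x * wₓ (suc p)) + 0ℚ
      ≡⟨ solve 2 (λ a b → a :+ b :+ con 0ℚ := b :+ a) refl
           ((1ℚ + x) * Σ) (ℕ→ℚ (suc p) * x * wₓ (suc p)) ⟩
    ℕ→ℚ (suc p) * x * wₓ (suc p) + (1ℚ + x) * Σ ∎
    where
    F : ℕ → ℚ
    F k = ℕ→ℚ (suc p C k) * wₓ (suc k) * ℓ (suc p ∸ k)
    Σ : ℚ
    Σ = sumLt p (λ k → ℕ→ℚ (suc p C k) * wₓ (suc p ∸ k ∸ 1) * wₓ (suc k))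
    corner : F (suc p) ≡ 0ℚ
    corner = begin
      c * ℓ (p ∸ p) ≡⟨ cong (λ m → c * ℓ m) (ℕP.n∸n≡0 p) ⟩
      c * ℓ 0       ≡⟨ cong (c *_) ℓ-zero ⟩
      c * 0ℚ        ≡⟨ ℚP.*-zeroʳ c ⟩
      0ℚ ∎
      where
      c : ℚ
      c = ℕ→ℚ (suc p C suc p) * wₓ (suc (suc p))
    diagonal : F p ≡ ℕ→ℚ (suc p) * x * wₓ (suc p)
    diagonal = begin
      ℕ→ℚ (suc p C p) * wₓ (suc p) * ℓ (suc p ∸ p)
        ≡⟨ cong₂ (λ c l → ℕ→ℚ c * wₓ (suc p) * l)
                 ([n+1]Cn≡n+1 p) (trans (cong ℓ (ℕP.m+n∸n≡m 1 p)) ℓ-one) ⟩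
      ℕ→ℚ (suc p) * wₓ (suc p) * x
        ≡⟨ solve 3 (λ s a y → s :* a :* y := s :* y :* a) refl (ℕ→ℚ (suc p)) (wₓ (suc p)) x ⟩
      ℕ→ℚ (suc p) * x * wₓ (suc p) ∎
    off-diagonal : sumLt p F ≡ (1ℚ + x) * Σ
    off-diagonal = trans (sumLt-cong p term) (sym (*-sumLt p (1ℚ + x) _))
      where
      term : ∀ k → k < p → F k ≡ (1ℚ + x) * (ℕ→ℚ (suc p C k) * wₓ (suc p ∸ k ∸ 1) * wₓ (suc k))
      term k k<p = begin
        c * wₓ (suc k) * ℓ (suc p ∸ k)              ≡⟨ cong (λ m → c * wₓ (suc k) * ℓ m) gap ⟩
        c * wₓ (suc k) * ℓ (suc (suc (p ∸ suc k)))  ≡⟨ cong (c * wₓ (suc k) *_) (ℓ-suc-suc (p ∸ suc k)) ⟩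
        c * wₓ (suc k) * ((1ℚ + x) * wₓ (suc (p ∸ suc k)))
          ≡⟨ solve 4 (λ c a b y → c :* a :* ((con 1ℚ :+ y) :* b) := (con 1ℚ :+ y) :* (c :* b :* a)) refl
               c (wₓ (suc k)) (wₓ (suc (p ∸ suc k))) x ⟩
        (1ℚ + x) * (c * wₓ (suc (p ∸ suc k)) * wₓ (suc k))
          ≡⟨ cong (λ m → (1ℚ + x) * (c * wₓ m * wₓ (suc k))) (sym (cong (_∸ 1) gap)) ⟩
        (1ℚ + x) * (c * wₓ (suc p ∸ k ∸ 1) * wₓ (suc k)) ∎
        where
        c : ℚ
        c = ℕ→ℚ (suc p C k)
        gap : suc p ∸ k ≡ suc (suc (p ∸ suc k))
        gap = [1+n]∸k≡2+[n∸[1+k]] k<p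

  Hw-suc : ∀ m → Hw (suc m) x ≡
    w (suc m) x + ℕ→ℚ m * x * w m x
      + (1ℚ + x) * sumLt (m ∸ 1) (λ k → ℕ→ℚ (m C k) * w (m ∸ k ∸ 1) x * w (suc k) x)
  Hw-suc m = begin
    Hw (suc m) x                             ≡⟨ Hw≡wₓ⊛ℓ (suc m) ⟩
    (wₓ ⊛ ℓ) (suc m)                         ≡⟨ ⊛-suc wₓ ℓ m ⟩
    ((wₓ ∘ suc) ⊛ ℓ) m + (wₓ ⊛ (ℓ ∘ suc)) m
      ≡⟨ cong₂ _+_ (wₓ∘suc⊛ℓ m) (wₓ⊛ℓ∘suc m) ⟩
    (mxw + (1ℚ + x) * Σ) + wₓ (suc m)
      ≡⟨ solve 3 (λ a b c → (a :+ b) :+ c := c :+ a :+ b) refl mxw ((1ℚ + x) * Σ) (wₓ (suc m)) ⟩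
    wₓ (suc m) + mxw + (1ℚ + x) * Σ ∎
    where
    mxw Σ : ℚ
    mxw = ℕ→ℚ m * x * wₓ m
    Σ = sumLt (m ∸ 1) (λ k → ℕ→ℚ (m C k) * wₓ (m ∸ k ∸ 1) * wₓ (suc k))

  -- The coefficients of x + u, which geom sends to x eᵗ.
  xeᵗ : ℕ → ℚ
  xeᵗ 0             = x
  xeᵗ 1             = 1ℚ
  xeᵗ (suc (suc _)) = 0ℚ

  ∂xeᵗ≡xeᵗ : ∀ k → ∂ xeᵗ k ≡ xeᵗ k
  ∂xeᵗ≡xeᵗ 0 = solve 1 (λ y → con 0ℚ :* y :+ y :* (con 1ℚ :* con 1ℚ) := y) refl x
  ∂xeᵗ≡xeᵗ 1 = solve 2 (λ y m → con 1ℚ :* con 1ℚ :+ y :* (m :* con 0ℚ) := con 1ℚ) refl x (ℕ→ℚ 2)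
  ∂xeᵗ≡xeᵗ (suc (suc k)) = solve 3 (λ y m m′ → m :* con 0ℚ :+ y :* (m′ :* con 0ℚ) := con 0ℚ) refl
    x (ℕ→ℚ (suc (suc k))) (ℕ→ℚ (suc (suc (suc k))))

  geom-xeᵗ : ∀ n → geom xeᵗ n ≡ x
  geom-xeᵗ zero    = geom-zero xeᵗ
  geom-xeᵗ (suc n) = trans (geom-suc xeᵗ n) (trans (geom-cong ∂xeᵗ≡xeᵗ n) (geom-xeᵗ n))

  ∂H : ℕ → ℚ
  ∂H = ∂ harmonic

  Hw-suc≡geom-∂H : ∀ k → Hw (suc k) x ≡ geom ∂H k
  Hw-suc≡geom-∂H k = trans (Hw≡geom-harmonic (suc k)) (geom-suc harmonic k)

  ∂H-closed : ∀ j → ∂H j ≡ (ℕ→ℚ j + x * ℕ→ℚ (suc j)) * harmonic j + x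
  ∂H-closed j = trans (cong (λ t → ℕ→ℚ j * harmonic j + x * t) (harmonic-suc j))
    (solve 4 (λ a s h y → a :* h :+ y :* (s :* h :+ con 1ℚ) := (a :+ y :* s) :* h :+ y) refl
      (ℕ→ℚ j) (ℕ→ℚ (suc j)) (harmonic j) x)

  ∂H⋆xeᵗ-suc : ∀ j → (∂H ⋆ xeᵗ) (suc j) ≡ ∂H j + x * ∂H (suc j)
  ∂H⋆xeᵗ-suc j = begin
    (sumLt j (λ i → ∂H i * xeᵗ (suc j ∸ i)) + ∂H j * xeᵗ (suc j ∸ j)) + ∂H (suc j) * xeᵗ (j ∸ j)
      ≡⟨ cong₂ (λ u v → (u + ∂H j * xeᵗ v) + ∂H (suc j) * xeᵗ (j ∸ j)) vanish (ℕP.m+n∸n≡m 1 j) ⟩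
    (0ℚ + ∂H j * 1ℚ) + ∂H (suc j) * xeᵗ (j ∸ j)
      ≡⟨ cong (λ v → (0ℚ + ∂H j * 1ℚ) + ∂H (suc j) * xeᵗ v) (ℕP.n∸n≡0 j) ⟩
    (0ℚ + ∂H j * 1ℚ) + ∂H (suc j) * x
      ≡⟨ solve 3 (λ a b y → (con 0ℚ :+ a :* con 1ℚ) :+ b :* y := a :+ y :* b) refl (∂H j) (∂H (suc j)) x ⟩
    ∂H j + x * ∂H (suc j) ∎
    where
    vanish : sumLt j (λ i → ∂H i * xeᵗ (suc j ∸ i)) ≡ 0ℚ
    vanish = sumLt-zero j _ (λ i i<j →
      trans (cong (λ m → ∂H i * xeᵗ m) ([1+n]∸k≡2+[n∸[1+k]] i<j)) (ℚP.*-zeroʳ (∂H i)))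

  -- Only at positive indices: at index 0 the two sides differ, which is why (ii) needs n ≥ 2.
  ∂[∂H⋆xeᵗ]-suc : ∀ i →
    ∂ (∂H ⋆ xeᵗ) (suc i) ≡ (1ℚ + x) * (∂ ∂H (suc i) - ∂H (suc i) - ∂ (const 1ℚ) (suc i) + 1ℚ)
  ∂[∂H⋆xeᵗ]-suc i = trans
    (cong₂ (λ u v → ℕ→ℚ (suc i) * u + x * (ℕ→ℚ (suc (suc i)) * v))
           (∂H⋆xeᵗ-suc i) (∂H⋆xeᵗ-suc (suc i)))
    (harmonic-key (ℕ→ℚ i) x (harmonic i) (harmonic (suc i)) (harmonic (suc (suc i)))
                  (ℕ→ℚ-suc i) (ℕ→ℚ-suc (suc i)) (ℕ→ℚ-suc (suc (suc i)))
                  (∂H-closed i) (∂H-closed (suc i)) (∂H-closed (suc (suc i)))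
                  (harmonic-suc i) (harmonic-suc (suc i)))

  x*binomial-sum-Hw : ∀ q → x * sumTo (suc (suc q)) (λ k → ℕ→ℚ (suc (suc q) C k) * Hw (suc k) x) ≡
    (1ℚ + x) * (Hw (suc (suc (suc q))) x - Hw (suc (suc q)) x - w (suc (suc q)) x + w (suc q) x)
  x*binomial-sum-Hw q = begin
    x * sumTo n (λ k → ℕ→ℚ (n C k) * Hw (suc k) x)    ≡⟨ *-sumLt (suc n) x _ ⟩
    sumTo n (λ k → x * (ℕ→ℚ (n C k) * Hw (suc k) x))  ≡⟨ sumLt-cong (suc n) (λ k _ → term k) ⟩
    (geom ∂H ⊛ geom xeᵗ) n                             ≡⟨ sym (geom-⋆ n ∂H xeᵗ) ⟩
    geom (∂H ⋆ xeᵗ) n                                  ≡⟨ geom-suc (∂H ⋆ xeᵗ) (suc q) ⟩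
    geom (∂ (∂H ⋆ xeᵗ)) (suc q)                        ≡⟨ geom-suc-cong ∂[∂H⋆xeᵗ]-suc q ⟩
    geom (λ k → (1ℚ + x) * D k) (suc q)                ≡⟨ geom-* (1ℚ + x) D (suc q) ⟩
    (1ℚ + x) * geom D (suc q)                          ≡⟨ cong ((1ℚ + x) *_) geom-D ⟩
    (1ℚ + x) * (Hw (suc n) x - Hw n x - w n x + w (suc q) x) ∎
    where
    n : ℕ
    n = suc (suc q)
    D : ℕ → ℚ
    D k = ∂ ∂H k - ∂H k - ∂ (const 1ℚ) k + 1ℚ
    term : ∀ k → x * (ℕ→ℚ (n C k) * Hw (suc k) x) ≡ ℕ→ℚ (n C k) * geom ∂H k * geom xeᵗ (n ∸ k)
    term k = trans (solve 3 (λ y c h → y :* (c :* h) := c :* h :* y) refl x (ℕ→ℚ (n C k)) (Hw (suc k) x))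
                   (cong₂ (λ h y → ℕ→ℚ (n C k) * h * y) (Hw-suc≡geom-∂H k) (sym (geom-xeᵗ (n ∸ k))))
    geom-D : geom D (suc q) ≡ Hw (suc n) x - Hw n x - w n x + w (suc q) x
    geom-D = begin
      geom D (suc q)
        ≡⟨ geom-+ (λ k → ∂ ∂H k - ∂H k - ∂ (const 1ℚ) k) (const 1ℚ) (suc q) ⟩
      geom (λ k → ∂ ∂H k - ∂H k - ∂ (const 1ℚ) k) (suc q) + geom (const 1ℚ) (suc q)
        ≡⟨ cong (_+ geom (const 1ℚ) (suc q)) (geom-- (λ k → ∂ ∂H k - ∂H k) (∂ (const 1ℚ)) (suc q)) ⟩
      geom (λ k → ∂ ∂H k - ∂H k) (suc q) - geom (∂ (const 1ℚ)) (suc q) + geom (const 1ℚ) (suc q)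
        ≡⟨ cong (λ t → t - geom (∂ (const 1ℚ)) (suc q) + geom (const 1ℚ) (suc q))
                (geom-- (∂ ∂H) ∂H (suc q)) ⟩
      geom (∂ ∂H) (suc q) - geom ∂H (suc q) - geom (∂ (const 1ℚ)) (suc q) + geom (const 1ℚ) (suc q)
        ≡⟨ sym (cong₂ _+_ (cong₂ _-_ (cong₂ _-_ Hw-n+1 (Hw-suc≡geom-∂H (suc q))) w-n)
                          (w≡geom-const1 (suc q))) ⟩
      Hw (suc n) x - Hw n x - w n x + w (suc q) x ∎
      where
      Hw-n+1 : Hw (suc n) x ≡ geom (∂ ∂H) (suc q)
      Hw-n+1 = trans (Hw-suc≡geom-∂H n) (geom-suc ∂H (suc q))
      w-n : w n x ≡ geom (∂ (const 1ℚ)) (suc q)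
      w-n = trans (w≡geom-const1 n) (geom-suc (const 1ℚ) (suc q))

proposition3 :
    ((m : ℕ) (x : ℚ) →
      Hw (suc m) x ≡
        w (suc m) x + ℕ→ℚ m * x * w m x
          + (1ℚ + x) * sumLt (m ∸ 1) (λ k → ℕ→ℚ (m C k) * w (m ∸ k ∸ 1) x * w (suc k) x))
    ×
    ((n : ℕ) → 2 ≤ n → (x : ℚ) → (nz : NonZero (1ℚ + x)) →
      (x ÷ (1ℚ + x)) {{nz}} * sumTo n (λ k → ℕ→ℚ (n C k) * Hw (suc k) x) ≡
        Hw (suc n) x - Hw n x - w n x + w (n ∸ 1) x)
proposition3 =
  (λ m x → Hw-suc x m) ,
  λ { (suc (suc q)) (s≤s (s≤s z≤n)) x nz → *≡*⇒÷*≡ x (1ℚ + x) _ _ {{nz}} (x*binomial-sum-Hw x q) }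
  where open GeometricTransform
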